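{- Let $n\ge 3$ and let $(\mathbf{d},\mathbf{r})$ be an arithmetical structure on the cycle graph $\mathcal{C}_n$. Then $d_i\le n+2$ for all $i\in[n]$. Moreover, the arithmetical structures on $\mathcal{C}_n$ with $d_i=n+2$ for some $i\in[n]$ are exactly the images under the dihedral symmetries of the following: (a) $\mathbf{d}=(1,n+2,2,2,\ldots,2)$ (for $n\ge3$); (b) $\mathbf{d}^k=(1,n+2,1,\underbrace{2,\ldots,2}_{k},3,\underbrace{2,\ldots,2}_{n-4-k})$ for $k\in\{0,1,\ldots,n-4\}$ (for $n\ge 4$). Furthermore, for each $k\in\{0,1,\ldots,n-4\}$, the structures $\mathbf{d}^k$ and $\mathbf{d}^{n-4-k}$ are symmetric (obtained from one another by a dihedral symmetry).
   Context: $\mathcal{C}_n$ is the cycle graph on vertices $v_1,\ldots,v_n$ with $v_i\sim v_{i+1}$ (indices mod $n$), and $A$ is its adjacency matrix. An arithmetical structure on $\mathcal{C}_n$ is a pair $(\mathbf{d},\mathbf{r})\in\mathbb{Z}^n_{>0}\times\mathbb{Z}^n_{>0}$ with $(\operatorname{diag}(\mathbf{d})-A)\mathbf{r}=\mathbf{0}$ and the entries of $\mathbf{r}$ having $\gcd$ $1$; $\mathbf{d}$ determines $\mathbf{r}$, so structures are referred to by $\mathbf{d}$. The dihedral group $D_{2n}$ acts on $\mathbb{Z}/n$ (viewing the vertices as those of a regular $n$-gon) and hence on structures by permuting the entries of $\mathbf{d}$ and $\mathbf{r}$ simultaneously; this maps arithmetical structures to arithmetical structures, and two structures in the same orbit are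 called symmetric. -}

module Defs where

open import Data.Nat using (ℕ; zero; suc; _+_; _*_; _∸_; _≤_; _<_; NonZero; _%_; _≡ᵇ_)
open import Data.Nat.DivMod using (m%n<n)
open import Data.Nat.Divisibility using (_∣_)
open import Data.Fin using (Fin; toℕ; fromℕ<)
open import Data.Bool using (if_then_else_)
open import Data.Product using (Σ; ∃; _×_; _,_)
open import Data.Sum using (_⊎_)
open import Relation.Binary.PropositionalEquality using (_≡_)

-- Vertices of C_n are Fin n; vertex v_{j+1} of the paper is index j.
-- Reduce a natural number mod n to a vertex.
idx : (n : ℕ) → .{{_ : NonZero n}} → ℕ → Fin n
idx n k = fromℕ< (m%n<n k n)

nxt : (n : ℕ) → .{{_ : NonZero n}} → Fin n → Fin n
nxt n i = idx n (suc (toℕ i))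

prv : (n : ℕ) → .{{_ : NonZero n}} → Fin n → Fin n
prv n i = idx n (toℕ i + (n ∸ 1))

IsArithStruct : (n : ℕ) → .{{_ : NonZero n}} → (Fin n → ℕ) → (Fin n → ℕ) → Set
IsArithStruct n d r =
  (∀ i → 0 < d i) × (∀ i → 0 < r i) ×
  (∀ i → d i * r i ≡ r (prv n i) + r (nxt n i)) ×
  (∀ g → (∀ i → g ∣ r i) → g ≡ 1)

-- d is an arithmetical structure (d determines r)
IsArithD : (n : ℕ) → .{{_ : NonZero n}} → (Fin n → ℕ) → Set
IsArithD n d = ∃ λ r → IsArithStruct n d r

rot : (n : ℕ) → .{{_ : NonZero n}} → ℕ → Fin n → Fin n
rot n a i = idx n (toℕ i + a)

refl' : (n : ℕ) → .{{_ : NonZero n}} → ℕ → Fin n → Fin n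
refl' n a i = idx n (a + (n ∸ toℕ i))

IsDihedral : (n : ℕ) → .{{_ : NonZero n}} → (Fin n → Fin n) → Set
IsDihedral n g = ∃ λ a → (∀ i → g i ≡ rot n a i) ⊎ (∀ i → g i ≡ refl' n a i)

Symmetric : (n : ℕ) → .{{_ : NonZero n}} → (Fin n → ℕ) → (Fin n → ℕ) → Set
Symmetric n d e = Σ (Fin n → Fin n) λ g → IsDihedral n g × (∀ i → e i ≡ d (g i))

dA : (n : ℕ) → Fin n → ℕ
dA n i = if toℕ i ≡ᵇ 0 then 1 else (if toℕ i ≡ᵇ 1 then n + 2 else 2)

dB : (n : ℕ) → ℕ → Fin n → ℕ
dB n k i =
  if toℕ i ≡ᵇ 0 then 1 else
  (if toℕ i ≡ᵇ 1 then n + 2 else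
  (if toℕ i ≡ᵇ 2 then 1 else
  (if toℕ i ≡ᵇ 3 + k then 3 else 2)))

{-# OPTIONS --safe #-}
-- Cut the cycle open at a vertex v₀ labelled (d₀, r₀) and read the labels (d, r) of the other
-- vertices in cyclic order. If all of them have d ≥ 2, then r is convex along this path, which
-- forces d₀ ≤ 2. Otherwise some vertex has d = 1, and smoothing it (deleting it and lowering the d
-- of its two neighbours by one) leaves an arithmetical structure on a cycle one vertex shorter in
-- which d₀ has dropped by at most one. Induction down to two vertices, where d₀ d₁ = 4, gives
-- d₀ ≤ n + 2. When d₀ = n + 2 every smoothing must happen next to v₀, and undoing them one at a
-- time pins the remaining labels down to those of (a), read in either direction, or of (b).
-- Conversely (a) and (b) carry explicit r-vectors, dihedral symmetries transport arithmetical
-- structures, and reading dᵏ backwards from its vertex with d = n + 2 gives dⁿ⁻⁴⁻ᵏ.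

module Submission where

open import Defs
open import Data.Bool using (if_then_else_)
open import Data.Empty using (⊥-elim)
open import Data.Fin using (Fin; toℕ)
open import Data.Fin.Properties using (toℕ-fromℕ<; toℕ-injective; toℕ<n)
open import Data.List
  using (List; []; _∷_; _++_; [_]; _∷ʳ_; reverse; map; length; replicate; applyUpTo; applyDownFrom)
open import Data.List.Properties
  using ( map-applyUpTo; length-applyUpTo; applyUpTo-∷ʳ; reverse-applyUpTo; ∷-injective; unfold-reverse
        ; reverse-++; reverse-involutive; reverse-map; length-reverse; ++-assoc)
open import Data.List.Relation.Unary.All using (All; []; _∷_)
open import Data.Nat
  using (ℕ; zero; suc; _+_; _*_; _∸_; _≤_; _<_; z≤n; s≤s; _≤?_; _%_; _≡ᵇ_; ∣_-_∣; NonZero; >-nonZero)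
open import Data.Nat.DivMod using (m%n<n; m%n%n≡m%n; [m+n]%n≡m%n; %-distribˡ-+; m<n⇒m%n≡m; n%n≡0)
open import Data.Nat.Divisibility using (_∣_; ∣1⇒≡1)
open import Data.Nat.Properties
open import Algebra.Properties.CommutativeSemigroup +-commutativeSemigroup
  using (x∙yz≈y∙xz; xy∙z≈y∙xz; xy∙z≈xz∙y)
open import Data.Nat.Tactic.RingSolver using (solve-∀)
open import Data.Product using (∃; _×_; _,_; proj₁; proj₂)
open import Data.Sum using (_⊎_; inj₁; inj₂)
open import Data.Unit using (⊤; tt)
open import Function.Bundles using (_⇔_; mk⇔)
open import Level using (0ℓ)
open import Relation.Binary.Bundles using (Setoid)
import Relation.Binary.Reasoning.Setoid
open import Relation.Binary.PropositionalEquality hiding ([_])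
open import Relation.Nullary using (yes; no)

r+r≤d*r : ∀ {d} r → 2 ≤ d → r + r ≤ d * r
r+r≤d*r {d} r 2≤d = subst (_≤ d * r) (cong (r +_) (+-identityʳ r)) (*-monoˡ-≤ r 2≤d)

convex-step : ∀ a b r h ℓ → r + r ≤ a + h → h + ℓ ≤ r + b → r + ℓ ≤ a + b
convex-step a b r h ℓ p q = +-cancelʳ-≤ (r + h) (r + ℓ) (a + b) (begin
  (r + ℓ) + (r + h)   ≡⟨ regroupˡ r ℓ h ⟩
  (r + r) + (h + ℓ)   ≤⟨ +-mono-≤ p q ⟩
  (a + h) + (r + b)   ≡⟨ regroupʳ a h r b ⟩
  (a + b) + (r + h)   ∎)
  where
  open ≤-Reasoning
  regroupˡ : ∀ r ℓ h → (r + ℓ) + (r + h) ≡ (r + r) + (h + ℓ)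
  regroupˡ = solve-∀
  regroupʳ : ∀ a h r b → (a + h) + (r + b) ≡ (a + b) + (r + h)
  regroupʳ = solve-∀

pred*≡ : ∀ d x y → d * x ≡ x + y → (d ∸ 1) * x ≡ y
pred*≡ d x y eq = begin
  (d ∸ 1) * x    ≡⟨ *-distribʳ-∸ x d 1 ⟩
  d * x ∸ 1 * x  ≡⟨ cong₂ _∸_ eq (*-identityˡ x) ⟩
  x + y ∸ x      ≡⟨ m+n∸m≡n x y ⟩
  y              ∎
  where open ≡-Reasoning

0<*⇒0<ʳ : ∀ d {r} → 0 < d * r → 0 < r
0<*⇒0<ʳ d {zero}  p = ⊥-elim (<-irrefl (sym (*-zeroʳ d)) p)
0<*⇒0<ʳ d {suc r} p = s≤s z≤n

0<*⇒0<ˡ : ∀ {d} r → 0 < d * r → 0 < d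
0<*⇒0<ˡ {suc d} r _ = s≤s z≤n

<2⇒≡1 : ∀ {d r} → d < 2 → 0 < d * r → d ≡ 1
<2⇒≡1 {zero}        _               ()
<2⇒≡1 {suc zero}    _               _ = refl
<2⇒≡1 {suc (suc d)} (s≤s (s≤s ())) _

∣m+n-m∣≡n : ∀ m n → ∣ m + n - m ∣ ≡ n
∣m+n-m∣≡n m n = trans (∣-∣-comm (m + n) m) (∣m-m+n∣≡n m n)

applyUpTo-cong< : ∀ {A : Set} {f g : ℕ → A} m → (∀ k → k < m → f k ≡ g k) →
                  applyUpTo f m ≡ applyUpTo g m
applyUpTo-cong< zero    same = refl
applyUpTo-cong< (suc m) same =
  cong₂ _∷_ (same 0 (s≤s z≤n)) (applyUpTo-cong< m (λ k k<m → same (suc k) (s≤s k<m)))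

applyUpTo-injective : ∀ {A : Set} {f g : ℕ → A} m → applyUpTo f m ≡ applyUpTo g m →
                      ∀ k → k < m → f k ≡ g k
applyUpTo-injective (suc m) eq zero    _         = proj₁ (∷-injective eq)
applyUpTo-injective (suc m) eq (suc k) (s≤s k<m) = applyUpTo-injective m (proj₂ (∷-injective eq)) k k<m

applyUpTo-const : ∀ {A : Set} (x : A) m → applyUpTo (λ _ → x) m ≡ replicate m x
applyUpTo-const x zero    = refl
applyUpTo-const x (suc m) = cong (x ∷_) (applyUpTo-const x m)

applyUpTo-spike : ∀ {A : Set} κ l (x y : A) →
  applyUpTo (λ k → if k ≡ᵇ κ then x else y) (suc (κ + l)) ≡ replicate κ y ++ x ∷ replicate l y
applyUpTo-spike zero    l x y = cong (x ∷_) (applyUpTo-const y l)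
applyUpTo-spike (suc κ) l x y = cong (y ∷_) (applyUpTo-spike κ l x y)

applyDownFrom≡applyUpTo : ∀ {A : Set} (f : ℕ → A) m →
                          applyDownFrom f m ≡ applyUpTo (λ k → f (m ∸ suc k)) m
applyDownFrom≡applyUpTo f zero    = refl
applyDownFrom≡applyUpTo f (suc m) = cong (f m ∷_) (applyDownFrom≡applyUpTo f m)

reverse-replicate : ∀ {A : Set} q (x : A) → reverse (replicate q x) ≡ replicate q x
reverse-replicate zero    x = refl
reverse-replicate (suc q) x = begin
  reverse (x ∷ replicate q x)  ≡⟨ unfold-reverse x (replicate q x) ⟩
  reverse (replicate q x) ∷ʳ x ≡⟨ cong (_∷ʳ x) (reverse-replicate q x) ⟩
  replicate q x ∷ʳ x           ≡⟨ replicate-∷ʳ q ⟩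
  x ∷ replicate q x            ∎
  where
  open ≡-Reasoning
  replicate-∷ʳ : ∀ q → replicate q x ∷ʳ x ≡ x ∷ replicate q x
  replicate-∷ʳ zero    = refl
  replicate-∷ʳ (suc q) = cong (x ∷_) (replicate-∷ʳ q)

reverse-++-∷ : ∀ {A : Set} (xs : List A) y ys →
               reverse (xs ++ y ∷ ys) ≡ reverse ys ++ y ∷ reverse xs
reverse-++-∷ xs y ys = begin
  reverse (xs ++ y ∷ ys)             ≡⟨ reverse-++ xs (y ∷ ys) ⟩
  reverse (y ∷ ys) ++ reverse xs     ≡⟨ cong (_++ reverse xs) (unfold-reverse y ys) ⟩
  (reverse ys ∷ʳ y) ++ reverse xs    ≡⟨ ++-assoc (reverse ys) [ y ] (reverse xs) ⟩
  reverse ys ++ y ∷ reverse xs       ∎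
  where open ≡-Reasoning

-- Cycles cut open at a vertex

Label : Set
Label = ℕ × ℕ

firstR : List Label → ℕ → ℕ
firstR []      b = b
firstR (e ∷ _) _ = proj₂ e

lastR : List Label → ℕ → ℕ
lastR []      a = a
lastR (e ∷ L) _ = lastR L (proj₂ e)

Balanced : ℕ → List Label → ℕ → Set
Balanced a []      b = ⊤
Balanced a (e ∷ L) b = proj₁ e * proj₂ e ≡ a + firstR L b × Balanced (proj₂ e) L b

-- An arithmetical structure, up to the gcd condition, on a cycle cut open at a vertex labelled (d₀, r₀);
-- L lists the labels (d, r) of the other vertices in cyclic order.
record ArithCycle (d₀ r₀ : ℕ) (L : List Label) : Set where
  field
    balanced  : Balanced r₀ L r₀
    balanced₀ : d₀ * r₀ ≡ firstR L r₀ + lastR L r₀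
    r₀-pos    : 0 < r₀

open ArithCycle

firstR-++ : ∀ P e T b → firstR (P ++ e ∷ T) b ≡ firstR P (proj₂ e)
firstR-++ []      e T b = refl
firstR-++ (_ ∷ _) e T b = refl

lastR-++ : ∀ P T a → lastR (P ++ T) a ≡ lastR T (lastR P a)
lastR-++ []      T a = refl
lastR-++ (e ∷ P) T a = lastR-++ P T (proj₂ e)

lastR-reverse : ∀ L a → lastR (reverse L) a ≡ firstR L a
lastR-reverse []      a = refl
lastR-reverse (e ∷ L) a = begin
  lastR (reverse (e ∷ L)) a  ≡⟨ cong (λ L′ → lastR L′ a) (unfold-reverse e L) ⟩
  lastR (reverse L ∷ʳ e) a   ≡⟨ lastR-++ (reverse L) [ e ] a ⟩
  proj₂ e                    ∎
  where open ≡-Reasoning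

firstR-reverse : ∀ L b → firstR (reverse L) b ≡ lastR L b
firstR-reverse []      b = refl
firstR-reverse (e ∷ L) b = begin
  firstR (reverse (e ∷ L)) b    ≡⟨ cong (λ L′ → firstR L′ b) (unfold-reverse e L) ⟩
  firstR (reverse L ++ [ e ]) b ≡⟨ firstR-++ (reverse L) e [] b ⟩
  firstR (reverse L) (proj₂ e)  ≡⟨ firstR-reverse L (proj₂ e) ⟩
  lastR L (proj₂ e)             ∎
  where open ≡-Reasoning

Balanced-∷ʳ : ∀ a L e b → Balanced a L (proj₂ e) → proj₁ e * proj₂ e ≡ lastR L a + b →
              Balanced a (L ∷ʳ e) b
Balanced-∷ʳ a []       e b _          eq = eq , tt
Balanced-∷ʳ a (e′ ∷ L) e b (eq′ , bal) eq =
  trans eq′ (cong (a +_) (sym (firstR-++ L e [] b))) , Balanced-∷ʳ (proj₂ e′) L e b bal eq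

Balanced-reverse : ∀ a L b → Balanced a L b → Balanced b (reverse L) a
Balanced-reverse a []      b _          = tt
Balanced-reverse a (e ∷ L) b (eq , bal) =
  subst (λ L′ → Balanced b L′ a) (sym (unfold-reverse e L))
    (Balanced-∷ʳ b (reverse L) e a (Balanced-reverse (proj₂ e) L b bal)
      (trans eq (trans (+-comm a (firstR L b)) (cong (_+ a) (sym (lastR-reverse L b))))))

ArithCycle-reverse : ∀ {d₀ r₀ L} → ArithCycle d₀ r₀ L → ArithCycle d₀ r₀ (reverse L)
ArithCycle-reverse {d₀} {r₀} {L} c = record
  { balanced  = Balanced-reverse r₀ L r₀ (balanced c)
  ; balanced₀ = trans (balanced₀ c)
      (trans (+-comm (firstR L r₀) (lastR L r₀))
             (sym (cong₂ _+_ (firstR-reverse L r₀) (lastR-reverse L r₀))))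
  ; r₀-pos    = r₀-pos c
  }

path : (D R : ℕ → ℕ) → ℕ → List Label
path D R m = applyUpTo (λ k → D (suc k) , R (suc k)) m

firstR-path : ∀ D R m → firstR (path D R m) (R (suc m)) ≡ R 1
firstR-path D R zero    = refl
firstR-path D R (suc m) = refl

lastR-path : ∀ D R m → lastR (path D R m) (R 0) ≡ R m
lastR-path D R zero    = refl
lastR-path D R (suc m) = lastR-path (λ k → D (suc k)) (λ k → R (suc k)) m

Balanced-path : ∀ D R → (∀ k → D (suc k) * R (suc k) ≡ R k + R (suc (suc k))) →
                ∀ m → Balanced (R 0) (path D R m) (R (suc m))
Balanced-path D R bal zero    = tt
Balanced-path D R bal (suc m) =
  trans (bal 0) (cong (R 0 +_) (sym (firstR-path (λ k → D (suc k)) (λ k → R (suc k)) m))) ,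
  Balanced-path (λ k → D (suc k)) (λ k → R (suc k)) (λ k → bal (suc k)) m

periodic-ArithCycle : ∀ D R m → (∀ k → D (suc k) * R (suc k) ≡ R k + R (suc (suc k))) →
  (∀ k → D (k + suc m) ≡ D k) → (∀ k → R (k + suc m) ≡ R k) → 0 < R 0 →
  ArithCycle (D 0) (R 0) (path D R m)
periodic-ArithCycle D R m bal D-per R-per 0<R₀ = record
  { balanced  = subst (Balanced (R 0) (path D R m)) (R-per 0) (Balanced-path D R bal m)
  ; balanced₀ = begin
      D 0 * R 0                  ≡⟨ cong₂ _*_ (D-per 0) (R-per 0) ⟨
      D (suc m) * R (suc m)      ≡⟨ bal m ⟩
      R m + R (1 + suc m)        ≡⟨ +-comm (R m) _ ⟩
      R (1 + suc m) + R m        ≡⟨ cong₂ _+_ (trans (R-per 1) (sym firstR≡R₁)) (sym (lastR-path D R m)) ⟩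
      firstR (path D R m) (R 0) + lastR (path D R m) (R 0) ∎
  ; r₀-pos    = 0<R₀
  }
  where
  open ≡-Reasoning
  firstR≡R₁ : firstR (path D R m) (R 0) ≡ R 1
  firstR≡R₁ = trans (cong (firstR (path D R m)) (sym (R-per 0))) (firstR-path D R m)

length-path : ∀ D R m → length (path D R m) ≡ m
length-path D R m = length-applyUpTo _ m

map-proj₁-path : ∀ D R m → map proj₁ (path D R m) ≡ applyUpTo (λ k → D (suc k)) m
map-proj₁-path D R m = map-applyUpTo _ proj₁ m

-- Smoothing a vertex with d = 1

-- d ≥ 2 makes r convex along the path, so its end values are dominated by the outer ones.
convex : ∀ a b e L → Balanced a (e ∷ L) b → All (λ e → 2 ≤ proj₁ e) (e ∷ L) →
         proj₂ e + lastR L (proj₂ e) ≤ a + b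
convex a b (d , r) []              (eq , _)   (2≤d ∷ _)     = subst (r + r ≤_) eq (r+r≤d*r r 2≤d)
convex a b (d , r) ((d′ , h) ∷ L) (eq , bal) (2≤d ∷ all≥2) =
  convex-step a b r h (lastR L h) (subst (r + r ≤_) eq (r+r≤d*r r 2≤d))
    (convex r b (d′ , h) L bal all≥2)

all≥2⇒d₀≤2 : ∀ {d₀ r₀ k} L → length L ≡ suc k → ArithCycle d₀ r₀ L →
             All (λ e → 2 ≤ proj₁ e) L → d₀ ≤ 2
all≥2⇒d₀≤2 {d₀} {r₀} (e ∷ L) _ c ps = *-cancelʳ-≤ d₀ 2 r₀ {{>-nonZero (r₀-pos c)}}
  (subst₂ _≤_ (sym (balanced₀ c)) (cong (r₀ +_) (sym (+-identityʳ r₀)))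
    (convex r₀ r₀ e L (balanced c) ps))

data Search (L : List Label) : Set where
  all≥2   : All (λ e → 2 ≤ proj₁ e) L → Search L
  first≡1 : ∀ r S → L ≡ (1 , r) ∷ S → Search L
  later≡1 : ∀ P e r S → L ≡ P ++ e ∷ (1 , r) ∷ S → Search L

-- Along a balanced path with positive outer value every r is positive, so d < 2 forces d = 1.
search : ∀ a L b → 0 < a → Balanced a L b → Search L
search a []            b _   _          = all≥2 []
search a ((d , r) ∷ L) b 0<a (eq , bal)
  with 2 ≤? d | subst (0 <_) (sym eq) (≤-trans 0<a (m≤m+n a (firstR L b)))
... | no  d≱2 | 0<dr = first≡1 r L (cong (λ d → (d , r) ∷ L) (<2⇒≡1 (≰⇒> d≱2) 0<dr))
... | yes 2≤d | 0<dr with search r L b (0<*⇒0<ʳ d 0<dr) bal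
...   | all≥2 ps              = all≥2 (2≤d ∷ ps)
...   | first≡1 r′ S refl     = later≡1 [] (d , r) r′ S refl
...   | later≡1 P e r′ S refl = later≡1 ((d , r) ∷ P) e r′ S refl

smooth-first : ∀ {d₀ r₀ r d₂ r₂ S} → ArithCycle d₀ r₀ ((1 , r) ∷ (d₂ , r₂) ∷ S) →
               ArithCycle (d₀ ∸ 1) r₀ ((d₂ ∸ 1 , r₂) ∷ S)
smooth-first {d₀} {r₀} {r} {d₂} {r₂} {S}
             record { balanced = eq₁ , eq₂ , bal ; balanced₀ = eq₀ ; r₀-pos = 0<r₀ } = record
  { balanced  = pred*≡ d₂ r₂ (r₀ + firstR S r₀)
                  (trans eq₂ (trans (cong (_+ firstR S r₀) r≡) (xy∙z≈y∙xz r₀ r₂ (firstR S r₀))))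
              , bal
  ; balanced₀ = pred*≡ d₀ r₀ (r₂ + lastR S r₂)
                  (trans eq₀ (trans (cong (_+ lastR S r₂) r≡) (+-assoc r₀ r₂ (lastR S r₂))))
  ; r₀-pos    = 0<r₀
  }
  where
  r≡ : r ≡ r₀ + r₂
  r≡ = trans (sym (+-identityʳ r)) eq₁

Balanced-smooth-later : ∀ a b P d₁ r₁ r d₂ r₂ S →
  Balanced a (P ++ (d₁ , r₁) ∷ (1 , r) ∷ (d₂ , r₂) ∷ S) b →
  Balanced a (P ++ (d₁ ∸ 1 , r₁) ∷ (d₂ ∸ 1 , r₂) ∷ S) b
Balanced-smooth-later a b [] d₁ r₁ r d₂ r₂ S (eq₁ , eq , eq₂ , bal) =
  pred*≡ d₁ r₁ (a + r₂) (trans eq₁ (trans (cong (a +_) r≡) (x∙yz≈y∙xz a r₁ r₂))) ,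
  pred*≡ d₂ r₂ (r₁ + firstR S b)
    (trans eq₂ (trans (cong (_+ firstR S b) r≡) (xy∙z≈y∙xz r₁ r₂ (firstR S b)))) ,
  bal
  where
  r≡ : r ≡ r₁ + r₂
  r≡ = trans (sym (+-identityʳ r)) eq
Balanced-smooth-later a b (e ∷ P) d₁ r₁ r d₂ r₂ S (eq , bal) =
  trans eq (cong (a +_) (trans (firstR-++ P (d₁ , r₁) _ b) (sym (firstR-++ P (d₁ ∸ 1 , r₁) _ b)))) ,
  Balanced-smooth-later (proj₂ e) b P d₁ r₁ r d₂ r₂ S bal

smooth-later : ∀ {d₀ r₀} P d₁ r₁ r d₂ r₂ S →
  ArithCycle d₀ r₀ (P ++ (d₁ , r₁) ∷ (1 , r) ∷ (d₂ , r₂) ∷ S) →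
  ArithCycle d₀ r₀ (P ++ (d₁ ∸ 1 , r₁) ∷ (d₂ ∸ 1 , r₂) ∷ S)
smooth-later {d₀} {r₀} P d₁ r₁ r d₂ r₂ S c = record
  { balanced  = Balanced-smooth-later r₀ r₀ P d₁ r₁ r d₂ r₂ S (balanced c)
  ; balanced₀ = trans (balanced₀ c) (cong₂ _+_
      (trans (firstR-++ P (d₁ , r₁) _ r₀) (sym (firstR-++ P (d₁ ∸ 1 , r₁) _ r₀)))
      (trans (lastR-++ P _ r₀) (sym (lastR-++ P _ r₀))))
  ; r₀-pos    = r₀-pos c
  }

length-smooth : ∀ P (e₁ e₁′ e e₂ e₂′ : Label) S →
                length (P ++ e₁ ∷ e ∷ e₂ ∷ S) ≡ suc (length (P ++ e₁′ ∷ e₂′ ∷ S))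
length-smooth []      _ _ _ _ _ S = refl
length-smooth (_ ∷ P) _ _ _ _ _ S = cong suc (length-smooth P _ _ _ _ _ S)

-- Smoothing a d = 1 vertex next to v₀ (after or before it) lowers d₀ by one; elsewhere it keeps d₀.
data Smoothing (d₀ r₀ : ℕ) (L : List Label) (m : ℕ) : Set where
  at-start : ∀ {d xs} L′ → map proj₁ L ≡ 1 ∷ d ∷ xs → map proj₁ L′ ≡ d ∸ 1 ∷ xs →
             length L′ ≡ suc m → ArithCycle (d₀ ∸ 1) r₀ L′ → Smoothing d₀ r₀ L m
  at-end   : ∀ {d xs} L′ → map proj₁ L ≡ reverse (1 ∷ d ∷ xs) → map proj₁ L′ ≡ d ∸ 1 ∷ xs →
             length L′ ≡ suc m → ArithCycle (d₀ ∸ 1) r₀ L′ → Smoothing d₀ r₀ L m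
  inside   : ∀ L′ → length L′ ≡ suc m → ArithCycle d₀ r₀ L′ → Smoothing d₀ r₀ L m

smooth : ∀ m {d₀ r₀} L → length L ≡ suc (suc m) → ArithCycle d₀ r₀ L → 3 ≤ d₀ →
         Smoothing d₀ r₀ L m
smooth m {d₀} {r₀} L len c 3≤d₀ with search r₀ L r₀ (r₀-pos c) (balanced c)
... | all≥2 ps = ⊥-elim (<⇒≱ 3≤d₀ (all≥2⇒d₀≤2 L len c ps))
... | first≡1 r [] refl = ⊥-elim (0≢1+n (suc-injective len))
... | first≡1 r ((d₂ , r₂) ∷ S) refl =
  at-start ((d₂ ∸ 1 , r₂) ∷ S) refl refl (suc-injective len) (smooth-first c)
... | later≡1 P (d₁ , r₁) r [] refl =
  at-end ((d₁ ∸ 1 , r₁) ∷ reverse P) map-L refl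
    (suc-injective (trans (cong length (sym rev)) (trans (length-reverse L) len)))
    (smooth-first (subst (ArithCycle d₀ r₀) rev (ArithCycle-reverse c)))
  where
  X : List Label
  X = (1 , r) ∷ (d₁ , r₁) ∷ reverse P
  rev : reverse L ≡ X
  rev = reverse-++ P ((d₁ , r₁) ∷ (1 , r) ∷ [])
  map-L : map proj₁ L ≡ reverse (map proj₁ X)
  map-L = trans (cong (map proj₁) (trans (sym (reverse-involutive L)) (cong reverse rev)))
                (reverse-map proj₁ X)
... | later≡1 P (d₁ , r₁) r ((d₂ , r₂) ∷ S) refl =
  inside (P ++ (d₁ ∸ 1 , r₁) ∷ (d₂ ∸ 1 , r₂) ∷ S)
    (suc-injective (trans (sym (length-smooth P _ _ (1 , r) _ _ S)) len))
    (smooth-later P d₁ r₁ r d₂ r₂ S c)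

-- The bound d₀ ≤ n + 2 and its extremal cases

d₁*d₀≡4 : ∀ {d₀ r₀ d₁ r₁} → ArithCycle d₀ r₀ ((d₁ , r₁) ∷ []) → d₁ * d₀ ≡ 4
d₁*d₀≡4 {d₀} {r₀} {d₁} {r₁} c = *-cancelʳ-≡ (d₁ * d₀) 4 r₀ {{>-nonZero (r₀-pos c)}} (begin
  d₁ * d₀ * r₀           ≡⟨ *-assoc d₁ d₀ r₀ ⟩
  d₁ * (d₀ * r₀)         ≡⟨ cong (d₁ *_) (balanced₀ c) ⟩
  d₁ * (r₁ + r₁)         ≡⟨ *-distribˡ-+ d₁ r₁ r₁ ⟩
  d₁ * r₁ + d₁ * r₁      ≡⟨ cong₂ _+_ (proj₁ (balanced c)) (proj₁ (balanced c)) ⟩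
  (r₀ + r₀) + (r₀ + r₀)  ≡⟨ quadruple r₀ ⟩
  4 * r₀                 ∎)
  where
  open ≡-Reasoning
  quadruple : ∀ r → (r + r) + (r + r) ≡ 4 * r
  quadruple = solve-∀

d₀≤m+4 : ∀ m {d₀ r₀} L → length L ≡ suc m → ArithCycle d₀ r₀ L → d₀ ≤ m + 4
d₀≤m+4 zero ((d₁ , r₁) ∷ []) _ c = ≤4 d₁ (d₁*d₀≡4 c)
  where
  ≤4 : ∀ m {n} → m * n ≡ 4 → n ≤ 4
  ≤4 (suc m) {n} eq = subst (n ≤_) eq (m≤n*m n (suc m))
d₀≤m+4 (suc m) {d₀} L len c with d₀ ≤? 2
... | yes d₀≤2 = ≤-trans d₀≤2 (≤-trans (s≤s (s≤s z≤n)) (m≤n+m 4 (suc m)))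
... | no  d₀≰2 with smooth m L len c (≰⇒> d₀≰2)
...   | at-start L′ _ _ len′ c′ = ≤-trans (m≤n+m∸n d₀ 1) (s≤s (d₀≤m+4 m L′ len′ c′))
...   | at-end   L′ _ _ len′ c′ = ≤-trans (m≤n+m∸n d₀ 1) (s≤s (d₀≤m+4 m L′ len′ c′))
...   | inside   L′ len′ c′     = m≤n⇒m≤1+n (d₀≤m+4 m L′ len′ c′)

arcᵃ : ℕ → List ℕ
arcᵃ q = replicate q 2 ∷ʳ 1

arcᵇ : ℕ → ℕ → List ℕ
arcᵇ k l = (1 ∷ replicate k 2 ++ 3 ∷ replicate l 2) ∷ʳ 1

-- The d-values met going once around a cycle of length q + 2 from a vertex with d = q + 4:
-- structure (a) in either direction, and structure (b) with k and l twos.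
data ExtremalArc : ℕ → List ℕ → Set where
  extremalᵃ  : ∀ q → ExtremalArc q (arcᵃ q)
  extremalᵃ⁻ : ∀ q → ExtremalArc q (1 ∷ replicate q 2)
  extremalᵇ  : ∀ k l → ExtremalArc (2 + k + l) (arcᵇ k l)

∷-pred-injective : ∀ {c} d {xs ys : List ℕ} → suc c ∷ xs ≡ d ∸ 1 ∷ ys →
                   d ≡ suc (suc c) × xs ≡ ys
∷-pred-injective (suc d) refl = refl , refl

unsmooth : ∀ {q ys d xs} → ExtremalArc q ys → ys ≡ d ∸ 1 ∷ xs → ExtremalArc (suc q) (1 ∷ d ∷ xs)
unsmooth {d = d} (extremalᵃ zero)    eq with ∷-pred-injective d eq
... | refl , refl = extremalᵃ⁻ 1
unsmooth {d = d} (extremalᵃ (suc q)) eq with ∷-pred-injective d eq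
... | refl , refl = extremalᵇ 0 q
unsmooth {d = d} (extremalᵃ⁻ q)      eq with ∷-pred-injective d eq
... | refl , refl = extremalᵃ⁻ (suc q)
unsmooth {d = d} (extremalᵇ k l)     eq with ∷-pred-injective d eq
... | refl , refl = extremalᵇ (suc k) l

reverse-arcᵃ : ∀ q → reverse (arcᵃ q) ≡ 1 ∷ replicate q 2
reverse-arcᵃ q = trans (reverse-++-∷ (replicate q 2) 1 []) (cong (1 ∷_) (reverse-replicate q 2))

reverse-arcᵇ : ∀ k l → reverse (arcᵇ k l) ≡ arcᵇ l k
reverse-arcᵇ k l = begin
  reverse ((1 ∷ M) ∷ʳ 1)    ≡⟨ reverse-++-∷ (1 ∷ M) 1 [] ⟩
  1 ∷ reverse (1 ∷ M)       ≡⟨ cong (1 ∷_) (unfold-reverse 1 M) ⟩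
  1 ∷ (reverse M ∷ʳ 1)
    ≡⟨ cong (λ M′ → 1 ∷ (M′ ∷ʳ 1)) (reverse-++-∷ (replicate k 2) 3 (replicate l 2)) ⟩
  1 ∷ (reverse (replicate l 2) ++ 3 ∷ reverse (replicate k 2)) ∷ʳ 1
    ≡⟨ cong₂ (λ L K → 1 ∷ (L ++ 3 ∷ K) ∷ʳ 1) (reverse-replicate l 2) (reverse-replicate k 2) ⟩
  arcᵇ l k                  ∎
  where
  open ≡-Reasoning
  M : List ℕ
  M = replicate k 2 ++ 3 ∷ replicate l 2

ExtremalArc-reverse : ∀ {q xs} → ExtremalArc q xs → ExtremalArc q (reverse xs)
ExtremalArc-reverse (extremalᵃ q)   = subst (ExtremalArc q) (sym (reverse-arcᵃ q)) (extremalᵃ⁻ q)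
ExtremalArc-reverse (extremalᵃ⁻ q)  =
  subst (ExtremalArc q) (trans (sym (reverse-involutive (arcᵃ q))) (cong reverse (reverse-arcᵃ q)))
    (extremalᵃ q)
ExtremalArc-reverse (extremalᵇ k l) =
  subst₂ ExtremalArc (cong (2 +_) (+-comm l k)) (sym (reverse-arcᵇ k l)) (extremalᵇ l k)

-- With d₀ maximal, no smoothing may keep d₀, so each one happens next to v₀ and can be undone.
d₀-max⇒ExtremalArc : ∀ q {d₀ r₀} L → length L ≡ suc q → ArithCycle d₀ r₀ L → d₀ ≡ q + 4 →
                     ExtremalArc q (map proj₁ L)
d₀-max⇒ExtremalArc zero ((d₁ , r₁) ∷ []) _ c refl =
  subst (λ d → ExtremalArc 0 (d ∷ [])) (sym (*-cancelʳ-≡ d₁ 1 4 (d₁*d₀≡4 c))) (extremalᵃ 0)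
d₀-max⇒ExtremalArc (suc q) L len c refl
  with smooth q L len c (s≤s (≤-trans (s≤s (s≤s z≤n)) (m≤n+m 4 q)))
... | inside   L′ len′ c′         = ⊥-elim (1+n≰n (d₀≤m+4 q L′ len′ c′))
... | at-start L′ eqL eqL′ len′ c′ =
  subst (ExtremalArc (suc q)) (sym eqL) (unsmooth (d₀-max⇒ExtremalArc q L′ len′ c′ refl) eqL′)
... | at-end   L′ eqL eqL′ len′ c′ =
  subst (ExtremalArc (suc q)) (sym eqL)
    (ExtremalArc-reverse (unsmooth (d₀-max⇒ExtremalArc q L′ len′ c′ refl) eqL′))

-- Vertices of the cycle as residues modulo n

module Cycle (m : ℕ) where

  n : ℕ
  n = suc m

  record _≈_ (x y : ℕ) : Set where
    constructor mod≡
    field %≡% : x % n ≡ y % n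

  infix 4 _≈_

  ≈-setoid : Setoid 0ℓ 0ℓ
  ≈-setoid = record
    { Carrier       = ℕ
    ; _≈_           = _≈_
    ; isEquivalence = record
      { refl  = mod≡ refl
      ; sym   = λ (mod≡ p) → mod≡ (sym p)
      ; trans = λ (mod≡ p) (mod≡ q) → mod≡ (trans p q)
      }
    }

  module ≈-Reasoning = Relation.Binary.Reasoning.Setoid ≈-setoid

  open Setoid ≈-setoid public using () renaming (refl to ≈-refl; sym to ≈-sym; trans to ≈-trans)

  ≡⇒≈ : ∀ {x y} → x ≡ y → x ≈ y
  ≡⇒≈ eq = mod≡ (cong (_% n) eq)

  +-cong : ∀ {x y u v} → x ≈ y → u ≈ v → x + u ≈ y + v
  +-cong {x} {y} {u} {v} (mod≡ p) (mod≡ q) = mod≡ (begin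
    (x + u) % n            ≡⟨ %-distribˡ-+ x u n ⟩
    (x % n + u % n) % n    ≡⟨ cong₂ (λ a b → (a + b) % n) p q ⟩
    (y % n + v % n) % n    ≡⟨ %-distribˡ-+ y v n ⟨
    (y + v) % n            ∎)
    where open ≡-Reasoning

  +-congˡ : ∀ x {u v} → u ≈ v → x + u ≈ x + v
  +-congˡ x = +-cong ≈-refl

  +-congʳ : ∀ {x y} u → x ≈ y → x + u ≈ y + u
  +-congʳ u p = +-cong p ≈-refl

  %≈ : ∀ x → x % n ≈ x
  %≈ x = mod≡ (m%n%n≡m%n x n)

  +n≈ : ∀ x → x + n ≈ x
  +n≈ x = mod≡ ([m+n]%n≡m%n x n)

  n≈0 : n ≈ 0
  n≈0 = +n≈ 0

  ∸+≈0 : ∀ {x} → x ≤ n → (n ∸ x) + x ≈ 0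
  ∸+≈0 x≤n = ≈-trans (≡⇒≈ (m∸n+n≡m x≤n)) n≈0

  +-cancelʳ-≈ : ∀ x y z → x + z ≈ y + z → x ≈ y
  +-cancelʳ-≈ x y z p = begin
    x                          ≡⟨ +-identityʳ x ⟨
    x + 0                      ≈⟨ +-congˡ x w+z≈0 ⟨
    x + (z + w)                ≡⟨ +-assoc x z w ⟨
    (x + z) + w                ≈⟨ +-congʳ w p ⟩
    (y + z) + w                ≡⟨ +-assoc y z w ⟩
    y + (z + w)                ≈⟨ +-congˡ y w+z≈0 ⟩
    y + 0                      ≡⟨ +-identityʳ y ⟩
    y                          ∎
    where
    open ≈-Reasoning
    w : ℕ
    w = n ∸ z % n
    w+z≈0 : z + w ≈ 0
    w+z≈0 = ≈-trans (+-congʳ w (≈-sym (%≈ z)))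
                    (≈-trans (≡⇒≈ (+-comm (z % n) w)) (∸+≈0 (<⇒≤ (m%n<n z n))))

  toℕ-idx : ∀ x → toℕ (idx n x) ≡ x % n
  toℕ-idx x = toℕ-fromℕ< (m%n<n x n)

  toℕ-idx≈ : ∀ x → toℕ (idx n x) ≈ x
  toℕ-idx≈ x = ≈-trans (≡⇒≈ (toℕ-idx x)) (%≈ x)

  idx-cong : ∀ {x y} → x ≈ y → idx n x ≡ idx n y
  idx-cong {x} {y} (mod≡ p) = toℕ-injective (trans (toℕ-idx x) (trans p (sym (toℕ-idx y))))

  idx-toℕ : ∀ (t : Fin n) → idx n (toℕ t) ≡ t
  idx-toℕ t = toℕ-injective (trans (toℕ-idx (toℕ t)) (m<n⇒m%n≡m (toℕ<n t)))

  nxt-idx : ∀ x → nxt n (idx n x) ≡ idx n (suc x)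
  nxt-idx x = idx-cong (+-congˡ 1 (toℕ-idx≈ x))

  prv-idx : ∀ x → prv n (idx n (suc x)) ≡ idx n x
  prv-idx x = idx-cong (begin
    toℕ (idx n (suc x)) + m  ≈⟨ +-congʳ m (toℕ-idx≈ (suc x)) ⟩
    suc x + m                ≡⟨ +-suc x m ⟨
    x + n                    ≈⟨ +n≈ x ⟩
    x                        ∎)
    where open ≈-Reasoning

  window : (Fin n → ℕ) → Fin n → ℕ → ℕ
  window f i k = f (idx n (toℕ i + k))

  arc : (Fin n → ℕ) → Fin n → List ℕ
  arc f i = applyUpTo (λ k → window f i (suc k)) m

  window-0 : ∀ f i → window f i 0 ≡ f i
  window-0 f i = cong f (trans (cong (idx n) (+-identityʳ (toℕ i))) (idx-toℕ i))

  window-periodic : ∀ f i k → window f i (k + n) ≡ window f i k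
  window-periodic f i k = cong f (idx-cong (≈-trans (≡⇒≈ (sym (+-assoc (toℕ i) k n))) (+n≈ _)))

  window-balanced : ∀ {d r} → IsArithStruct n d r → ∀ i k →
    window d i (suc k) * window r i (suc k) ≡ window r i k + window r i (suc (suc k))
  window-balanced {d} {r} (_ , _ , balanced , _) i k = trans (balanced j) (cong₂ (λ u v → r u + r v)
    (trans (cong (prv n) j≡) (prv-idx (toℕ i + k)))
    (trans (nxt-idx (toℕ i + suc k)) (cong (idx n) (sym (+-suc (toℕ i) (suc k))))))
    where
    j : Fin n
    j = idx n (toℕ i + suc k)
    j≡ : j ≡ idx n (suc (toℕ i + k))
    j≡ = cong (idx n) (+-suc (toℕ i) k)

  cut : (d r : Fin n → ℕ) → Fin n → List Label
  cut d r i = path (window d i) (window r i) m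

  length-cut : ∀ d r i → length (cut d r i) ≡ m
  length-cut d r i = length-path (window d i) (window r i) m

  map-proj₁-cut : ∀ d r i → map proj₁ (cut d r i) ≡ arc d i
  map-proj₁-cut d r i = map-proj₁-path (window d i) (window r i) m

  linearise : ∀ {d r} → IsArithStruct n d r → ∀ i → ArithCycle (d i) (r i) (cut d r i)
  linearise {d} {r} st@(_ , r-pos , _ , _) i =
    subst₂ (λ d₀ r₀ → ArithCycle d₀ r₀ (cut d r i)) (window-0 d i) (window-0 r i)
      (periodic-ArithCycle (window d i) (window r i) m (window-balanced st i)
        (window-periodic d i) (window-periodic r i) (r-pos _))

  offset : Fin n → Fin n → ℕ
  offset i t = (toℕ t + (n ∸ toℕ i)) % n

  idx-offset : ∀ (i t : Fin n) → idx n (toℕ i + offset i t) ≡ t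
  idx-offset i t = trans (idx-cong (begin
    toℕ i + (toℕ t + (n ∸ toℕ i)) % n  ≈⟨ +-congˡ (toℕ i) (%≈ _) ⟩
    toℕ i + (toℕ t + (n ∸ toℕ i))      ≡⟨ x∙yz≈y∙xz (toℕ i) (toℕ t) _ ⟩
    toℕ t + (toℕ i + (n ∸ toℕ i))      ≡⟨ cong (toℕ t +_) (m+[n∸m]≡n (<⇒≤ (toℕ<n i))) ⟩
    toℕ t + n                          ≈⟨ +n≈ (toℕ t) ⟩
    toℕ t                              ∎)) (idx-toℕ t)
    where open ≈-Reasoning

  offset<n : ∀ (i t : Fin n) → offset i t < n
  offset<n i t = m%n<n (toℕ t + (n ∸ toℕ i)) n

  toℕ≈offset : ∀ (i t : Fin n) → toℕ t ≈ toℕ i + offset i t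
  toℕ≈offset i t = ≈-trans (≡⇒≈ (cong toℕ (sym (idx-offset i t)))) (toℕ-idx≈ _)

  rotation-symmetric : ∀ {d e : Fin n → ℕ} i j → (∀ k → k < n → window d i k ≡ window e j k) →
                       Symmetric n e d
  rotation-symmetric {d} {e} i j same = rot n a , (a , inj₁ (λ _ → refl)) , λ t → begin
    d t                       ≡⟨ cong d (idx-offset i t) ⟨
    window d i (offset i t)   ≡⟨ same (offset i t) (offset<n i t) ⟩
    window e j (offset i t)   ≡⟨ cong e (idx-cong (shift t)) ⟩
    e (rot n a t)             ∎
    where
    open ≡-Reasoning
    a : ℕ
    a = toℕ j + (n ∸ toℕ i)
    shift : ∀ t → toℕ j + offset i t ≈ toℕ t + a
    shift t = ≈-trans (+-congˡ (toℕ j) (%≈ _)) (≡⇒≈ (x∙yz≈y∙xz (toℕ j) (toℕ t) _))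

  -- Adding toℕ t ≈ toℕ i + offset i t turns both sides into toℕ i + toℕ j.
  offset-mirror : ∀ (i j t : Fin n) → toℕ j + (n ∸ offset i t) ≈ (toℕ i + toℕ j) + (n ∸ toℕ t)
  offset-mirror i j t = +-cancelʳ-≈ (toℕ j + (n ∸ k)) (a + (n ∸ toℕ t)) (toℕ t) (begin
    (toℕ j + (n ∸ k)) + toℕ t        ≈⟨ +-congˡ (toℕ j + (n ∸ k)) (toℕ≈offset i t) ⟩
    (toℕ j + (n ∸ k)) + (toℕ i + k)  ≡⟨ regroup (toℕ i) (toℕ j) (n ∸ k) k ⟩
    a + ((n ∸ k) + k)                ≈⟨ +-congˡ a (∸+≈0 (<⇒≤ (offset<n i t))) ⟩
    a + 0                            ≈⟨ +-congˡ a (∸+≈0 (<⇒≤ (toℕ<n t))) ⟨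
    a + ((n ∸ toℕ t) + toℕ t)        ≡⟨ +-assoc a _ (toℕ t) ⟨
    (a + (n ∸ toℕ t)) + toℕ t        ∎)
    where
    open ≈-Reasoning
    a : ℕ
    a = toℕ i + toℕ j
    k : ℕ
    k = offset i t
    regroup : ∀ i j x k → (j + x) + (i + k) ≡ (i + j) + (x + k)
    regroup = solve-∀

  reflection-symmetric : ∀ {d e : Fin n → ℕ} i j → (∀ k → k < n → window d i k ≡ window e j (n ∸ k)) →
                         Symmetric n e d
  reflection-symmetric {d} {e} i j opposite = refl' n a , (a , inj₂ (λ _ → refl)) , λ t → begin
    d t                            ≡⟨ cong d (idx-offset i t) ⟨
    window d i (offset i t)        ≡⟨ opposite (offset i t) (offset<n i t) ⟩
    window e j (n ∸ offset i t)    ≡⟨ cong e (idx-cong (offset-mirror i j t)) ⟩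
    e (refl' n a t)                ∎
    where
    open ≡-Reasoning
    a : ℕ
    a = toℕ i + toℕ j

  arc-rotation : ∀ {d e : Fin n → ℕ} i j → d i ≡ e j → arc d i ≡ arc e j → Symmetric n e d
  arc-rotation {d} {e} i j at-i same-arc = rotation-symmetric {d} {e} i j same-window
    where
    same-window : ∀ k → k < n → window d i k ≡ window e j k
    same-window zero    _         = trans (window-0 d i) (trans at-i (sym (window-0 e j)))
    same-window (suc k) (s≤s k<m) = applyUpTo-injective m same-arc k k<m

  arc-reflection : ∀ {d e : Fin n → ℕ} i j → d i ≡ e j → arc d i ≡ reverse (arc e j) → Symmetric n e d
  arc-reflection {d} {e} i j at-i opposite-arc = reflection-symmetric {d} {e} i j opposite-window
    where
    arcs : arc d i ≡ applyUpTo (λ k → window e j (suc (m ∸ suc k))) m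
    arcs = trans opposite-arc (trans (reverse-applyUpTo _ m) (applyDownFrom≡applyUpTo _ m))
    opposite-window : ∀ k → k < n → window d i k ≡ window e j (n ∸ k)
    opposite-window zero    _         =
      trans (window-0 d i) (trans at-i (sym (trans (window-periodic e j 0) (window-0 e j))))
    opposite-window (suc k) (s≤s k<m) =
      trans (applyUpTo-injective m arcs k k<m) (cong (window e j) (sym (+-∸-assoc 1 k<m)))

  rot-nxt : ∀ a t → rot n a (nxt n t) ≡ nxt n (rot n a t)
  rot-nxt a t = idx-cong (begin
    toℕ (nxt n t) + a      ≈⟨ +-congʳ a (toℕ-idx≈ (suc (toℕ t))) ⟩
    suc (toℕ t + a)        ≈⟨ +-congˡ 1 (toℕ-idx≈ (toℕ t + a)) ⟨
    suc (toℕ (rot n a t))  ∎)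
    where open ≈-Reasoning

  rot-prv : ∀ a t → rot n a (prv n t) ≡ prv n (rot n a t)
  rot-prv a t = idx-cong (begin
    toℕ (prv n t) + a    ≈⟨ +-congʳ a (toℕ-idx≈ (toℕ t + m)) ⟩
    (toℕ t + m) + a      ≡⟨ xy∙z≈xz∙y (toℕ t) m a ⟩
    (toℕ t + a) + m      ≈⟨ +-congʳ m (toℕ-idx≈ (toℕ t + a)) ⟨
    toℕ (rot n a t) + m  ∎)
    where open ≈-Reasoning

  reflect-cancel : ∀ a (t : Fin n) → (a + (n ∸ toℕ t)) + toℕ t ≈ a
  reflect-cancel a t = begin
    (a + (n ∸ toℕ t)) + toℕ t  ≡⟨ +-assoc a _ (toℕ t) ⟩
    a + ((n ∸ toℕ t) + toℕ t)  ≈⟨ +-congˡ a (∸+≈0 (<⇒≤ (toℕ<n t))) ⟩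
    a + 0                      ≡⟨ +-identityʳ a ⟩
    a                          ∎
    where open ≈-Reasoning

  refl-nxt : ∀ a t → refl' n a (nxt n t) ≡ prv n (refl' n a t)
  refl-nxt a t = idx-cong (+-cancelʳ-≈ x y (suc (toℕ t)) (begin
    x + suc (toℕ t)                             ≈⟨ +-congˡ x (toℕ-idx≈ (suc (toℕ t))) ⟨
    (a + (n ∸ toℕ (nxt n t))) + toℕ (nxt n t)   ≈⟨ reflect-cancel a (nxt n t) ⟩
    a                                           ≈⟨ reflect-cancel a t ⟨
    z + toℕ t                                   ≈⟨ +n≈ (z + toℕ t) ⟨
    (z + toℕ t) + suc m                         ≡⟨ regroup z (toℕ t) m ⟩
    (z + m) + suc (toℕ t)                       ≈⟨ +-congʳ (suc (toℕ t)) (+-congʳ m (toℕ-idx≈ z)) ⟨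
    y + suc (toℕ t)                             ∎))
    where
    open ≈-Reasoning
    x y z : ℕ
    x = a + (n ∸ toℕ (nxt n t))
    y = toℕ (refl' n a t) + m
    z = a + (n ∸ toℕ t)
    regroup : ∀ y t m → (y + t) + suc m ≡ (y + m) + suc t
    regroup = solve-∀

  refl-prv : ∀ a t → refl' n a (prv n t) ≡ nxt n (refl' n a t)
  refl-prv a t = idx-cong (+-cancelʳ-≈ x y (toℕ t + m) (begin
    x + (toℕ t + m)                             ≈⟨ +-congˡ x (toℕ-idx≈ (toℕ t + m)) ⟨
    (a + (n ∸ toℕ (prv n t))) + toℕ (prv n t)   ≈⟨ reflect-cancel a (prv n t) ⟩
    a                                           ≈⟨ reflect-cancel a t ⟨
    z + toℕ t                                   ≈⟨ +n≈ (z + toℕ t) ⟨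
    (z + toℕ t) + suc m                         ≡⟨ regroup z (toℕ t) m ⟩
    suc z + (toℕ t + m)                         ≈⟨ +-congʳ (toℕ t + m) (+-congˡ 1 (toℕ-idx≈ z)) ⟨
    y + (toℕ t + m)                             ∎))
    where
    open ≈-Reasoning
    x y z : ℕ
    x = a + (n ∸ toℕ (prv n t))
    y = suc (toℕ (refl' n a t))
    z = a + (n ∸ toℕ t)
    regroup : ∀ y t m → (y + t) + suc m ≡ suc y + (t + m)
    regroup = solve-∀

  dihedral-neighbours : ∀ {g} → IsDihedral n g → ∀ (s : Fin n → ℕ) t →
    s (g (prv n t)) + s (g (nxt n t)) ≡ s (prv n (g t)) + s (nxt n (g t))
  dihedral-neighbours {g} (a , inj₁ g≗rot) s t = cong₂ _+_
    (cong s (trans (g≗rot (prv n t)) (trans (rot-prv a t) (cong (prv n) (sym (g≗rot t))))))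
    (cong s (trans (g≗rot (nxt n t)) (trans (rot-nxt a t) (cong (nxt n) (sym (g≗rot t))))))
  dihedral-neighbours {g} (a , inj₂ g≗refl) s t = trans (+-comm (s (g (prv n t))) _) (cong₂ _+_
    (cong s (trans (g≗refl (nxt n t)) (trans (refl-nxt a t) (cong (prv n) (sym (g≗refl t))))))
    (cong s (trans (g≗refl (prv n t)) (trans (refl-prv a t) (cong (nxt n) (sym (g≗refl t)))))))

  rot-inverse : ∀ a u → rot n a (rot n (n ∸ a % n) u) ≡ u
  rot-inverse a u = trans (idx-cong (begin
    toℕ (rot n (n ∸ a % n) u) + a    ≈⟨ +-congʳ a (toℕ-idx≈ _) ⟩
    (toℕ u + (n ∸ a % n)) + a        ≡⟨ +-assoc (toℕ u) _ a ⟩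
    toℕ u + ((n ∸ a % n) + a)        ≈⟨ +-congˡ (toℕ u) (+-congˡ (n ∸ a % n) (%≈ a)) ⟨
    toℕ u + ((n ∸ a % n) + a % n)    ≈⟨ +-congˡ (toℕ u) (∸+≈0 (<⇒≤ (m%n<n a n))) ⟩
    toℕ u + 0                        ≡⟨ +-identityʳ (toℕ u) ⟩
    toℕ u                            ∎)) (idx-toℕ u)
    where open ≈-Reasoning

  refl-involutive : ∀ a u → refl' n a (refl' n a u) ≡ u
  refl-involutive a u = trans (idx-cong (+-cancelʳ-≈ (a + (n ∸ toℕ v)) (toℕ u) (toℕ v) (begin
    (a + (n ∸ toℕ v)) + toℕ v   ≈⟨ reflect-cancel a v ⟩
    a                           ≈⟨ reflect-cancel a u ⟨
    (a + (n ∸ toℕ u)) + toℕ u   ≡⟨ +-comm _ (toℕ u) ⟩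
    toℕ u + (a + (n ∸ toℕ u))   ≈⟨ +-congˡ (toℕ u) (toℕ-idx≈ _) ⟨
    toℕ u + toℕ v               ∎))) (idx-toℕ u)
    where
    open ≈-Reasoning
    v : Fin n
    v = refl' n a u

  dihedral-surjective : ∀ {g} → IsDihedral n g → ∀ u → ∃ λ t → g t ≡ u
  dihedral-surjective (a , inj₁ g≗rot)  u = rot n (n ∸ a % n) u , trans (g≗rot _) (rot-inverse a u)
  dihedral-surjective (a , inj₂ g≗refl) u = refl' n a u , trans (g≗refl _) (refl-involutive a u)

  transport : ∀ {e s d : Fin n → ℕ} {g} → IsDihedral n g → IsArithStruct n e s →
              (∀ t → d t ≡ e (g t)) → IsArithStruct n d (λ t → s (g t))
  transport {e} {s} {d} {g} dih (e-pos , s-pos , balanced , gcd≡1) d≗ =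
    (λ t → subst (0 <_) (sym (d≗ t)) (e-pos (g t))) ,
    (λ t → s-pos (g t)) ,
    (λ t → begin
       d t * s (g t)                        ≡⟨ cong (_* s (g t)) (d≗ t) ⟩
       e (g t) * s (g t)                    ≡⟨ balanced (g t) ⟩
       s (prv n (g t)) + s (nxt n (g t))    ≡⟨ dihedral-neighbours dih s t ⟨
       s (g (prv n t)) + s (g (nxt n t))    ∎) ,
    λ h h∣ → gcd≡1 h λ u → let (t , gt≡u) = dihedral-surjective dih u in subst (λ v → h ∣ s v) gt≡u (h∣ t)
    where open ≡-Reasoning

  arith-structure : ∀ {d r : Fin n → ℕ} → (∀ t → d t * r t ≡ r (prv n t) + r (nxt n t)) →
                    (∀ t → 0 < r t) → ∀ v → r v ≡ 1 → IsArithStruct n d r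
  arith-structure {d} {r} balanced r-pos v rv≡1 =
    (λ t → 0<*⇒0<ˡ (r t) (subst (0 <_) (sym (balanced t)) (≤-trans (r-pos (prv n t)) (m≤m+n _ _)))) ,
    r-pos , balanced , λ h h∣ → ∣1⇒≡1 (subst (h ∣_) rv≡1 (h∣ v))

  symmetric-arith : ∀ {e s d : Fin n → ℕ} → IsArithStruct n e s → Symmetric n e d → IsArithD n d
  symmetric-arith st (g , dih , d≗) = _ , transport dih st d≗

  symmetric-attains : ∀ {e d : Fin n → ℕ} → Symmetric n e d → ∀ j → ∃ λ i → d i ≡ e j
  symmetric-attains {e} (g , dih , d≗) j with dihedral-surjective dih j
  ... | i , gi≡j = i , trans (d≗ i) (cong e gi≡j)

-- The structures (a) and (b)

-- dA n t = dᵃ n (toℕ t) and dB n κ t = dᵇ n κ (toℕ t) hold by definition.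
dᵃ : ℕ → ℕ → ℕ
dᵃ n k = if k ≡ᵇ 0 then 1 else (if k ≡ᵇ 1 then n + 2 else 2)

dᵇ : ℕ → ℕ → ℕ → ℕ
dᵇ n κ k =
  if k ≡ᵇ 0 then 1 else
  (if k ≡ᵇ 1 then n + 2 else
  (if k ≡ᵇ 2 then 1 else
  (if k ≡ᵇ 3 + κ then 3 else 2)))

rᵃ : ℕ → ℕ → ℕ
rᵃ n zero    = n
rᵃ n (suc k) = suc k

rᵇ : ℕ → ℕ → ℕ → ℕ
rᵇ κ l zero          = 3 + l
rᵇ κ l (suc zero)    = 1
rᵇ κ l (suc (suc j)) = 2 + ∣ j - suc κ ∣

-- r is piecewise linear with slopes ∓1 around its minimum, so it is balanced by d = 2 except at the kink.
kink : ∀ j κ → (if j ≡ᵇ κ then 3 else 2) * (2 + ∣ j - κ ∣) ≡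
               (2 + ∣ j - suc κ ∣) + (2 + ∣ suc j - κ ∣)
kink zero    zero    = refl
kink zero    (suc κ) = descending κ
  where
  descending : ∀ κ → 2 * (2 + suc κ) ≡ (2 + suc (suc κ)) + (2 + κ)
  descending = solve-∀
kink (suc j) zero    =
  subst (λ x → 2 * (2 + suc j) ≡ (2 + x) + (2 + suc (suc j))) (sym (∣-∣-identityʳ j)) (ascending j)
  where
  ascending : ∀ j → 2 * (2 + suc j) ≡ (2 + j) + (2 + suc (suc j))
  ascending = solve-∀
kink (suc j) (suc κ) = kink j κ

module Cycle≥2 (m : ℕ) where

  open Cycle (suc m) public

  balanced-from-ℕ : (e s : ℕ → ℕ) →
    e 0 * s 0 ≡ s (suc m) + s 1 →
    (∀ k → k < m → e (suc k) * s (suc k) ≡ s k + s (suc (suc k))) →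
    e (suc m) * s (suc m) ≡ s m + s 0 →
    ∀ t → e (toℕ t) * s (toℕ t) ≡ s (toℕ (prv n t)) + s (toℕ (nxt n t))
  balanced-from-ℕ e s first inner last t =
    trans (at (toℕ t) (toℕ<n t))
      (sym (cong₂ (λ u v → s u + s v) (toℕ-idx (toℕ t + suc m)) (toℕ-idx (suc (toℕ t)))))
    where
    before : ∀ k → k < n → (suc k + suc m) % n ≡ k
    before k k<n = trans (cong (_% n) (sym (+-suc k (suc m)))) (trans ([m+n]%n≡m%n k n) (m<n⇒m%n≡m k<n))
    at : ∀ k → k < n → e k * s k ≡ s ((k + suc m) % n) + s (suc k % n)
    at zero _ = trans first (cong (λ u → s u + s 1) (sym (m<n⇒m%n≡m ≤-refl)))
    at (suc k) (s≤s (s≤s k≤m)) with m≤n⇒m<n∨m≡n k≤m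
    ... | inj₁ k<m = trans (inner k k<m)
          (sym (cong₂ (λ u v → s u + s v) (before k (m<n⇒m<1+n (m<n⇒m<1+n k<m)))
                                          (m<n⇒m%n≡m (s≤s (s≤s k<m)))))
    ... | inj₂ refl =
          trans last (sym (cong₂ (λ u v → s u + s v) (before k (m<n⇒m<1+n (n<1+n k))) (n%n≡0 n)))

  arc-from-1 : ∀ (f : ℕ → ℕ) →
               arc (λ t → f (toℕ t)) (idx n 1) ≡ applyUpTo (λ k → f (2 + k)) m ∷ʳ f 0
  arc-from-1 f = begin
    applyUpTo h (suc m)        ≡⟨ applyUpTo-∷ʳ h m ⟨
    applyUpTo h m ∷ʳ h m
      ≡⟨ cong₂ _∷ʳ_ (applyUpTo-cong< m below-n) (cong f (trans (toℕ-idx n) (n%n≡0 n))) ⟩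
    applyUpTo (λ k → f (2 + k)) m ∷ʳ f 0 ∎
    where
    open ≡-Reasoning
    h : ℕ → ℕ
    h k = f (toℕ (idx n (2 + k)))
    below-n : ∀ k → k < m → h k ≡ f (2 + k)
    below-n k k<m = cong f (trans (toℕ-idx (2 + k)) (m<n⇒m%n≡m (s≤s (s≤s k<m))))

  arc-dA : arc (dA n) (idx n 1) ≡ arcᵃ m
  arc-dA = trans (arc-from-1 (dᵃ n)) (cong (_∷ʳ 1) (applyUpTo-const 2 m))

  structureᵃ : IsArithStruct n (dA n) (λ t → rᵃ n (toℕ t))
  structureᵃ = arith-structure (balanced-from-ℕ (dᵃ n) (rᵃ n) first inner (closing m))
                               (λ t → positive (toℕ t)) (idx n 1) refl
    where
    linear : ∀ k → 2 * suc (suc k) ≡ suc k + suc (suc (suc k))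
    linear = solve-∀
    first : 1 * n ≡ suc m + 1
    first = trans (+-identityʳ n) (+-comm 1 (suc m))
    inner : ∀ k → k < m → dᵃ n (suc k) * rᵃ n (suc k) ≡ rᵃ n k + rᵃ n (suc (suc k))
    inner zero    _ = *-identityʳ (n + 2)
    inner (suc k) _ = linear k
    closing : ∀ m → dᵃ (2 + m) (suc m) * rᵃ (2 + m) (suc m) ≡ rᵃ (2 + m) m + rᵃ (2 + m) 0
    closing zero    = refl
    closing (suc k) = linear k
    positive : ∀ k → 0 < rᵃ n k
    positive zero    = s≤s z≤n
    positive (suc k) = s≤s z≤n

  n+2≡m+4 : n + 2 ≡ m + 4
  n+2≡m+4 = trans (+-comm (2 + m) 2) (+-comm 4 m)

  arith-bound : ∀ {d r} → IsArithStruct n d r → ∀ i → d i ≤ n + 2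
  arith-bound {d} {r} st i =
    subst (d i ≤_) (sym n+2≡m+4) (d₀≤m+4 m (cut d r i) (length-cut d r i) (linearise st i))

  extremal-arc : ∀ {d r} → IsArithStruct n d r → ∀ i → d i ≡ n + 2 → ExtremalArc m (arc d i)
  extremal-arc {d} {r} st i at-i = subst (ExtremalArc m) (map-proj₁-cut d r i)
    (d₀-max⇒ExtremalArc m (cut d r i) (length-cut d r i) (linearise st i) (trans at-i n+2≡m+4))

module FamilyB (κ l : ℕ) where

  open Cycle≥2 (2 + κ + l) public

  arc-dB : ∀ κ′ l′ → κ′ + l′ ≡ κ + l → arc (dB n κ′) (idx n 1) ≡ arcᵇ κ′ l′
  arc-dB κ′ l′ eq = trans (arc-from-1 (dᵇ n κ′)) (cong (λ xs → (1 ∷ xs) ∷ʳ 1) (trans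
    (cong (λ x → applyUpTo (λ k → if k ≡ᵇ κ′ then 3 else 2) (suc x)) (sym eq))
    (applyUpTo-spike κ′ l′ 3 2)))

  structureᵇ : IsArithStruct n (dB n κ) (λ t → rᵇ κ l (toℕ t))
  structureᵇ = arith-structure (balanced-from-ℕ (dᵇ n κ) (rᵇ κ l) first inner last)
                               (λ t → positive (toℕ t)) (idx n 1) refl
    where
    shift : ∀ l → (3 + l) + 0 ≡ (2 + l) + 1
    shift = solve-∀
    peak : ∀ κ l → (4 + κ + l + 2) * 1 ≡ (3 + l) + (2 + suc κ)
    peak = solve-∀
    first : 1 * rᵇ κ l 0 ≡ rᵇ κ l (3 + (κ + l)) + 1
    first = trans (shift l) (cong (λ x → (2 + x) + 1) (sym (∣m+n-m∣≡n κ l)))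
    inner : ∀ k → k < suc (suc (κ + l)) →
            dᵇ n κ (suc k) * rᵇ κ l (suc k) ≡ rᵇ κ l k + rᵇ κ l (suc (suc k))
    inner zero          _ = peak κ l
    inner (suc zero)    _ = +-identityʳ (3 + κ)
    inner (suc (suc j)) _ = kink j κ
    last : dᵇ n κ (3 + (κ + l)) * rᵇ κ l (3 + (κ + l)) ≡ rᵇ κ l (2 + (κ + l)) + rᵇ κ l 0
    last = trans (kink (κ + l) κ)
      (cong (λ x → rᵇ κ l (2 + (κ + l)) + (2 + x))
            (trans (cong (λ x → ∣ x - κ ∣) (sym (+-suc κ l))) (∣m+n-m∣≡n κ (suc l))))
    positive : ∀ k → 0 < rᵇ κ l k
    positive zero          = s≤s z≤n
    positive (suc zero)    = s≤s z≤n
    positive (suc (suc j)) = s≤s z≤n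

  dB-symmetric : Symmetric n (dB n κ) (dB n l)
  dB-symmetric = arc-reflection {dB n l} {dB n κ} (idx n 1) (idx n 1) refl (begin
    arc (dB n l) (idx n 1)             ≡⟨ arc-dB l κ (+-comm l κ) ⟩
    arcᵇ l κ                           ≡⟨ reverse-arcᵇ κ l ⟨
    reverse (arcᵇ κ l)                 ≡⟨ cong reverse (arc-dB κ l refl) ⟨
    reverse (arc (dB n κ) (idx n 1))   ∎)
    where open ≡-Reasoning

ExtremalArc⇒symmetric : ∀ m {d : Fin (2 + m) → ℕ} i → d i ≡ (2 + m) + 2 →
  ∀ {xs} → ExtremalArc m xs → Cycle≥2.arc m d i ≡ xs →
  Symmetric (2 + m) (dA (2 + m)) d
  ⊎ (4 ≤ 2 + m × ∃ λ κ → κ ≤ (2 + m) ∸ 4 × Symmetric (2 + m) (dB (2 + m) κ) d)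
ExtremalArc⇒symmetric m {d} i at-i (extremalᵃ .m) arc≡ =
  inj₁ (arc-rotation {d} {dA n} i (idx n 1) at-i (trans arc≡ (sym arc-dA)))
  where open Cycle≥2 m
ExtremalArc⇒symmetric m {d} i at-i (extremalᵃ⁻ .m) arc≡ =
  inj₁ (arc-reflection {d} {dA n} i (idx n 1) at-i
         (trans arc≡ (trans (sym (reverse-arcᵃ m)) (cong reverse (sym arc-dA)))))
  where open Cycle≥2 m
ExtremalArc⇒symmetric .(2 + κ + l) {d} i at-i (extremalᵇ κ l) arc≡ =
  inj₂ (s≤s (s≤s (s≤s (s≤s z≤n))) , κ , m≤m+n κ l ,
        arc-rotation {d} {dB n κ} i (idx n 1) at-i (trans arc≡ (sym (arc-dB κ l refl))))
  where open FamilyB κ l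

dB-arithmetical : ∀ m κ → 4 ≤ 2 + m → κ ≤ (2 + m) ∸ 4 → IsArithD (2 + m) (dB (2 + m) κ)
dB-arithmetical zero          κ (s≤s (s≤s ())) _
dB-arithmetical (suc zero)    κ (s≤s (s≤s (s≤s ()))) _
dB-arithmetical (suc (suc p)) κ _ κ≤p =
  subst (λ x → IsArithD (4 + x) (dB (4 + x) κ)) (m+[n∸m]≡n κ≤p) (_ , FamilyB.structureᵇ κ (p ∸ κ))

dB-symmetric-complement : ∀ m → 4 ≤ 2 + m → ∀ κ → κ ≤ (2 + m) ∸ 4 →
                          Symmetric (2 + m) (dB (2 + m) κ) (dB (2 + m) ((2 + m) ∸ 4 ∸ κ))
dB-symmetric-complement zero          (s≤s (s≤s ()))
dB-symmetric-complement (suc zero)    (s≤s (s≤s (s≤s ())))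
dB-symmetric-complement (suc (suc p)) _ κ κ≤p =
  subst (λ x → Symmetric (4 + x) (dB (4 + x) κ) (dB (4 + x) (x ∸ κ))) (m+[n∸m]≡n κ≤p)
    (subst (λ y → Symmetric (4 + (κ + (p ∸ κ))) (dB _ κ) (dB _ y)) (sym (m+n∸m≡n κ (p ∸ κ)))
      (FamilyB.dB-symmetric κ (p ∸ κ)))

proposition4p1 : (n : ℕ) → .{{_ : NonZero n}} → 3 ≤ n →
    ((d r : Fin n → ℕ) → IsArithStruct n d r → ∀ i → d i ≤ n + 2)
    × ((d : Fin n → ℕ) →
        (IsArithD n d × ∃ (λ i → d i ≡ n + 2))
        ⇔ (Symmetric n (dA n) d
           ⊎ (4 ≤ n × ∃ (λ k → k ≤ n ∸ 4 × Symmetric n (dB n k) d))))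
    × (4 ≤ n → (k : ℕ) → k ≤ n ∸ 4 → Symmetric n (dB n k) (dB n (n ∸ 4 ∸ k)))
proposition4p1 (suc (suc (suc p))) _ =
  (λ d r st → arith-bound st) , (λ d → mk⇔ classify construct) , dB-symmetric-complement (suc p)
  where
  open Cycle≥2 (suc p)
  Extremal Classified : (Fin n → ℕ) → Set
  Extremal d = IsArithD n d × ∃ (λ i → d i ≡ n + 2)
  Classified d = Symmetric n (dA n) d ⊎ (4 ≤ n × ∃ (λ κ → κ ≤ n ∸ 4 × Symmetric n (dB n κ) d))
  classify : ∀ {d} → Extremal d → Classified d
  classify ((r , st) , i , at-i) = ExtremalArc⇒symmetric (suc p) i at-i (extremal-arc st i at-i) refl
  construct : ∀ {d} → Classified d → Extremal d
  construct (inj₁ sym-a) =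
    symmetric-arith structureᵃ sym-a , symmetric-attains {dA n} sym-a (idx n 1)
  construct (inj₂ (4≤n , κ , κ≤ , sym-b)) =
    symmetric-arith (proj₂ (dB-arithmetical (suc p) κ 4≤n κ≤)) sym-b ,
    symmetric-attains {dB n κ} sym-b (idx n 1)
proposition4p1 (suc zero)       (s≤s ())
proposition4p1 (suc (suc zero)) (s≤s (s≤s ()))
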